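{- The inclusion functor $\mathscr C\to\mathscr D$ is CULF, i.e. the induced simplicial map of fat nerves $\mathbf N\mathscr C\to\mathbf N\mathscr D$ is CULF.
   Context: For $n\in\mathbb N$ let $\underline n=\{1,\dots,n\}$. $\mathscr C$ is the category whose objects are surjections $p:\underline n\twoheadrightarrow\underline k$ between such standard sets, and whose morphisms from $p:\underline n\twoheadrightarrow\underline k$ to $p':\underline n\twoheadrightarrow\underline k'$ (same domain) are surjections $f:\underline k\twoheadrightarrow\underline k'$ with $f\circ p=p'$ (the map on the common domain being the identity); it is equivalent to the partition poset. $\mathscr D$ is the category with the same kind of objects (surjections; equivalently, up to equivalence of categories, surjections between arbitrary finite sets), where a morphism from $p:E\twoheadrightarrow K$ to $p':E'\twoheadrightarrow K'$ is a pair consisting of a bijection $\sigma:E\to E'$ and a surjection $f:K\twoheadrightarrow K'$ with $f\circ p=p'\circ\sigma$. The fat nerve of a category has $n$-simplices the groupoid of sequences of $n$ composable arrows and natural isomorphisms. A simplicial map $F$ is CULF if its naturality squares for all codegeneracy maps and inner coface maps are homotopy pullbacks (intuitively: it inverts no non-identity arrows and induces equivalences between groupoids of factorisations of an arrow and of its image). -}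

module Defs where

open import Level using (0ℓ)
open import Data.Nat using (ℕ; zero; suc)
open import Data.Fin using (Fin; zero; suc)
open import Data.Product using (Σ; ∃; _×_; _,_; proj₁; proj₂; Σ-syntax; ∃-syntax)
open import Relation.Binary.PropositionalEquality using (_≡_; refl; sym; trans; cong; subst)
open import Relation.Binary.PropositionalEquality.Properties using (subst-subst)
open import Function.Bundles using (_↔_; Inverse)
open import Function.Construct.Identity using (↔-id)
open import Function.Construct.Composition using (_↔-∘_)

record CatData : Set₁ where
  infixr 9 _∙_
  field
    Obj : Set
    Hom : Obj → Obj → Set
    _≈_ : ∀ {a b} → Hom a b → Hom a b → Set
    idC : ∀ {a} → Hom a a
    _∙_ : ∀ {a b c} → Hom b c → Hom a b → Hom a c

record FunData (𝒜 ℬ : CatData) : Set where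
  field
    F₀ : CatData.Obj 𝒜 → CatData.Obj ℬ
    F₁ : ∀ {a b} → CatData.Hom 𝒜 a b → CatData.Hom ℬ (F₀ a) (F₀ b)

-- Groupoid data: objects, "pre-morphisms", a predicate singling out the
-- genuine morphisms, equality of morphisms, composition.

record GpdData : Set₁ where
  infixr 9 _∙_
  field
    Obj : Set
    PHom : Obj → Obj → Set
    Valid : ∀ {x y} → PHom x y → Set
    _≈_ : ∀ {x y} → PHom x y → PHom x y → Set
    _∙_ : ∀ {x y z} → PHom y z → PHom x y → PHom x z

record GFun (X Y : GpdData) : Set where
  field
    f₀ : GpdData.Obj X → GpdData.Obj Y
    f₁ : ∀ {x y} → GpdData.PHom X x y → GpdData.PHom Y (f₀ x) (f₀ y)

-- A square    X --H--> A
--             |K       |F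
--             v        v
--             B --G--> C     with 2-cell θ x : F (H x) → G (K x)
-- is a homotopy pullback iff the comparison functor
-- X → A ×ʰ_C B,  x ↦ (H x , K x , θ x)  is fully faithful and
-- essentially surjective.  Objects of A ×ʰ_C B are triples (a, b, γ : F a → G b),
-- morphisms (a,b,γ) → (a',b',γ') are pairs (α , β) with  G β ∙ γ ≈ γ' ∙ F α.

record Square : Set₁ where
  field
    X A B C : GpdData
    H : GFun X A
    K : GFun X B
    F : GFun A C
    G : GFun B C
    θ : ∀ x → GpdData.PHom C (GFun.f₀ F (GFun.f₀ H x)) (GFun.f₀ G (GFun.f₀ K x))

module _ (sq : Square) where
  open Square sq
  private
    module X = GpdData X
    module A = GpdData A
    module B = GpdData B
    module C = GpdData C
    module H = GFun H
    module K = GFun K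
    module F = GFun F
    module G = GFun G

  ComparisonFull : Set
  ComparisonFull =
    ∀ x x' (α : A.PHom (H.f₀ x) (H.f₀ x')) (β : B.PHom (K.f₀ x) (K.f₀ x')) →
    A.Valid α → B.Valid β → (G.f₁ β C.∙ θ x) C.≈ (θ x' C.∙ F.f₁ α) →
    ∃[ φ ] (X.Valid φ × (H.f₁ φ A.≈ α) × (K.f₁ φ B.≈ β))

  ComparisonFaithful : Set
  ComparisonFaithful =
    ∀ x x' (φ φ' : X.PHom x x') → X.Valid φ → X.Valid φ' →
    H.f₁ φ A.≈ H.f₁ φ' → K.f₁ φ B.≈ K.f₁ φ' → φ X.≈ φ'

  ComparisonEssSurj : Set
  ComparisonEssSurj =
    ∀ a b (γ : C.PHom (F.f₀ a) (G.f₀ b)) → C.Valid γ →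
    ∃[ x ] ∃[ α ] ∃[ β ]
      (A.Valid {H.f₀ x} {a} α × B.Valid {K.f₀ x} {b} β × ((G.f₁ β C.∙ θ x) C.≈ (γ C.∙ F.f₁ α)))

  IsHomotopyPullback : Set
  IsHomotopyPullback = ComparisonFull × ComparisonFaithful × ComparisonEssSurj

-- Fat nerve of a category: N n has objects the chains of n composable
-- arrows, morphisms the natural isomorphisms between chains.

module Nerve (𝒞 : CatData) where
  open CatData 𝒞

  infixr 5 _∷_
  data Chain : ℕ → Obj → Obj → Set where
    []  : ∀ {a} → Chain 0 a a
    _∷_ : ∀ {n a b c} → Hom a b → Chain n b c → Chain (suc n) a c

  record NObj (n : ℕ) : Set where
    constructor nobj
    field
      {src tgt} : Obj
      chain : Chain n src tgt

  -- a family of pairs (forward, backward) of arrows, one for each object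
  -- of the chain
  infixr 5 _∷ᵐ_
  data PHomC : ∀ {n a c a' c'} → Chain n a c → Chain n a' c' → Set where
    []ᵐ  : ∀ {a a'} → Hom a a' → Hom a' a → PHomC ([] {a}) ([] {a'})
    _∷ᵐ_ : ∀ {n a b c a' b' c'} {f : Hom a b} {r : Chain n b c}
             {f' : Hom a' b'} {r' : Chain n b' c'} →
           Hom a a' × Hom a' a → PHomC r r' → PHomC (f ∷ r) (f' ∷ r')

  headPair : ∀ {n a c a' c'} {s : Chain n a c} {t : Chain n a' c'} →
             PHomC s t → Hom a a' × Hom a' a
  headPair ([]ᵐ u v) = u , v
  headPair (p ∷ᵐ _) = p

  IsIso : ∀ {a b} → Hom a b → Hom b a → Set
  IsIso u v = ((v ∙ u) ≈ idC) × ((u ∙ v) ≈ idC)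

  ValidC : ∀ {n a c a' c'} {s : Chain n a c} {t : Chain n a' c'} → PHomC s t → Set
  ValidC ([]ᵐ u v) = IsIso u v
  ValidC (_∷ᵐ_ {f = f} {f' = f'} (u , v) φ) =
    IsIso u v × ((f' ∙ u) ≈ (proj₁ (headPair φ) ∙ f)) × ValidC φ

  EqC : ∀ {n a c a' c'} {s : Chain n a c} {t : Chain n a' c'} → PHomC s t → PHomC s t → Set
  EqC ([]ᵐ u _) ([]ᵐ u' _) = u ≈ u'
  EqC ((u , _) ∷ᵐ φ) ((u' , _) ∷ᵐ ψ) = (u ≈ u') × EqC φ ψ

  compC : ∀ {n a c a' c' a'' c''} {s : Chain n a c} {t : Chain n a' c'} {w : Chain n a'' c''} →
          PHomC t w → PHomC s t → PHomC s w
  compC ([]ᵐ u v) ([]ᵐ u' v') = []ᵐ (u ∙ u') (v' ∙ v)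
  compC ((u , v) ∷ᵐ φ) ((u' , v') ∷ᵐ ψ) = (u ∙ u' , v' ∙ v) ∷ᵐ compC φ ψ

  idPH : ∀ {n a c} (s : Chain n a c) → PHomC s s
  idPH [] = []ᵐ idC idC
  idPH (f ∷ s) = (idC , idC) ∷ᵐ idPH s

  N : ℕ → GpdData
  N n = record
    { Obj = NObj n
    ; PHom = λ x y → PHomC (NObj.chain x) (NObj.chain y)
    ; Valid = ValidC
    ; _≈_ = EqC
    ; _∙_ = compC
    }

  -- inner face maps: compAt k composes the arrows number k and k+1
  -- (0-based), i.e. it is d_{k+1} : N (n+2) → N (n+1).
  compAt : ∀ {n a c} → Fin (suc n) → Chain (suc (suc n)) a c → Chain (suc n) a c
  compAt zero (f ∷ g ∷ r) = (g ∙ f) ∷ r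
  compAt {suc n} (suc k) (f ∷ r) = f ∷ compAt k r

  dropAt : ∀ {n a c a' c'} (k : Fin (suc n)) {s : Chain (suc (suc n)) a c}
           {t : Chain (suc (suc n)) a' c'} → PHomC s t → PHomC (compAt k s) (compAt k t)
  dropAt zero (p ∷ᵐ (_ ∷ᵐ ρ)) = p ∷ᵐ ρ
  dropAt {suc n} (suc k) (p ∷ᵐ ρ) = p ∷ᵐ dropAt k ρ

  face : ∀ n → Fin (suc n) → GFun (N (suc (suc n))) (N (suc n))
  face n k = record
    { f₀ = λ x → nobj (compAt k (NObj.chain x))
    ; f₁ = dropAt k
    }

  -- degeneracy maps: insId i inserts an identity at object number i,
  -- i.e. it is s_i : N n → N (n+1).
  insId : ∀ {n a c} → Fin (suc n) → Chain n a c → Chain (suc n) a c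
  insId zero r = idC ∷ r
  insId {suc n} (suc i) (f ∷ r) = f ∷ insId i r

  dupAt : ∀ {n a c a' c'} (i : Fin (suc n)) {s : Chain n a c}
          {t : Chain n a' c'} → PHomC s t → PHomC (insId i s) (insId i t)
  dupAt zero φ = headPair φ ∷ᵐ φ
  dupAt {suc n} (suc i) (p ∷ᵐ ρ) = p ∷ᵐ dupAt i ρ

  degen : ∀ n → Fin (suc n) → GFun (N n) (N (suc n))
  degen n i = record
    { f₀ = λ x → nobj (insId i (NObj.chain x))
    ; f₁ = dupAt i
    }

module NerveMap {𝒞 𝒟 : CatData} (Φ : FunData 𝒞 𝒟) where
  open FunData Φ
  private
    module NC = Nerve 𝒞
    module ND = Nerve 𝒟
  open CatData 𝒟 using (idC)
  open NC using (_∷_; []; _∷ᵐ_; []ᵐ)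
  open ND using () renaming (_∷_ to _∷'_; [] to []'; _∷ᵐ_ to _∷ᵐ'_; []ᵐ to []ᵐ')

  mapCh : ∀ {n a c} → NC.Chain n a c → ND.Chain n (F₀ a) (F₀ c)
  mapCh [] = []'
  mapCh (f ∷ r) = F₁ f ∷' mapCh r

  mapPH : ∀ {n a c a' c'} {s : NC.Chain n a c} {t : NC.Chain n a' c'} →
          NC.PHomC s t → ND.PHomC (mapCh s) (mapCh t)
  mapPH ([]ᵐ u v) = []ᵐ' (F₁ u) (F₁ v)
  mapPH ((u , v) ∷ᵐ φ) = (F₁ u , F₁ v) ∷ᵐ' mapPH φ

  Nmap : ∀ n → GFun (NC.N n) (ND.N n)
  Nmap n = record { f₀ = λ x → ND.nobj (mapCh (NC.NObj.chain x)) ; f₁ = mapPH }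

  θface : ∀ {n a c} (k : Fin (suc n)) (s : NC.Chain (suc (suc n)) a c) →
          ND.PHomC (ND.compAt k (mapCh s)) (mapCh (NC.compAt k s))
  θface zero (f ∷ g ∷ r) = (idC , idC) ∷ᵐ' ND.idPH (mapCh r)
  θface {suc n} (suc k) (f ∷ r) = (idC , idC) ∷ᵐ' θface k r

  θdegen : ∀ {n a c} (i : Fin (suc n)) (s : NC.Chain n a c) →
           ND.PHomC (mapCh (NC.insId i s)) (ND.insId i (mapCh s))
  θdegen zero r = (idC , idC) ∷ᵐ' ND.idPH (mapCh r)
  θdegen {suc n} (suc i) (f ∷ r) = (idC , idC) ∷ᵐ' θdegen i r

  faceSquare : ∀ n → Fin (suc n) → Square
  faceSquare n k = record
    { X = NC.N (suc (suc n)) ; A = ND.N (suc (suc n))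
    ; B = NC.N (suc n) ; C = ND.N (suc n)
    ; H = Nmap (suc (suc n)) ; K = NC.face n k
    ; F = ND.face n k ; G = Nmap (suc n)
    ; θ = λ x → θface k (NC.NObj.chain x)
    }

  degenSquare : ∀ n → Fin (suc n) → Square
  degenSquare n i = record
    { X = NC.N n ; A = NC.N (suc n)
    ; B = ND.N n ; C = ND.N (suc n)
    ; H = NC.degen n i ; K = Nmap n
    ; F = Nmap (suc n) ; G = ND.degen n i
    ; θ = λ x → θdegen i (NC.NObj.chain x)
    }

  IsCULF : Set
  IsCULF = (∀ n (i : Fin (suc n)) → IsHomotopyPullback (degenSquare n i))
         × (∀ n (k : Fin (suc n)) → IsHomotopyPullback (faceSquare n k))

IsSurj : ∀ {n k} → (Fin n → Fin k) → Set
IsSurj {n} {k} f = ∀ (j : Fin k) → ∃[ i ] f i ≡ j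

record SurjObj : Set where
  constructor surjObj
  field
    dom cod : ℕ
    map : Fin dom → Fin cod
    surj : IsSurj map
open SurjObj

∘-surj : ∀ {a b c} {g : Fin b → Fin c} {f : Fin a → Fin b} →
         IsSurj g → IsSurj f → IsSurj (λ x → g (f x))
∘-surj {f = f} sg sf j with sg j
... | (y , gy≡j) with sf y
... | (x , fx≡y) = x , trans (cong _ fx≡y) gy≡j

id-surj : ∀ {k} → IsSurj {k} {k} (λ x → x)
id-surj j = j , refl

record CHom (P Q : SurjObj) : Set where
  field
    sameDom : dom P ≡ dom Q
    fun : Fin (cod P) → Fin (cod Q)
    funSurj : IsSurj fun
    commutes : ∀ i → fun (map P i) ≡ map Q (subst Fin sameDom i)

CId : ∀ {P} → CHom P P
CId = record { sameDom = refl ; fun = λ x → x ; funSurj = id-surj ; commutes = λ i → refl }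

CComp : ∀ {P Q R} → CHom Q R → CHom P Q → CHom P R
CComp {P} {Q} {R} g f = record
  { sameDom = trans (CHom.sameDom f) (CHom.sameDom g)
  ; fun = λ x → CHom.fun g (CHom.fun f x)
  ; funSurj = ∘-surj (CHom.funSurj g) (CHom.funSurj f)
  ; commutes = λ i → trans (cong (CHom.fun g) (CHom.commutes f i))
                     (trans (CHom.commutes g _)
                       (cong (map R) (subst-subst (CHom.sameDom f))))
  }

𝒞 : CatData
𝒞 = record
  { Obj = SurjObj
  ; Hom = CHom
  ; _≈_ = λ f g → ∀ j → CHom.fun f j ≡ CHom.fun g j
  ; idC = CId
  ; _∙_ = CComp
  }

record DHom (P Q : SurjObj) : Set where
  field
    bij : Fin (dom P) ↔ Fin (dom Q)
    fun : Fin (cod P) → Fin (cod Q)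
    funSurj : IsSurj fun
    commutes : ∀ i → fun (map P i) ≡ map Q (Inverse.to bij i)

DId : ∀ {P} → DHom P P
DId {P} = record { bij = ↔-id (Fin (dom P)) ; fun = λ x → x ; funSurj = id-surj ; commutes = λ i → refl }

DComp : ∀ {P Q R} → DHom Q R → DHom P Q → DHom P R
DComp {P} {Q} {R} g f = record
  { bij = DHom.bij g ↔-∘ DHom.bij f
  ; fun = λ x → DHom.fun g (DHom.fun f x)
  ; funSurj = ∘-surj (DHom.funSurj g) (DHom.funSurj f)
  ; commutes = λ i → trans (cong (DHom.fun g) (DHom.commutes f i)) (DHom.commutes g _)
  }

𝒟 : CatData
𝒟 = record
  { Obj = SurjObj
  ; Hom = DHom
  ; _≈_ = λ f g → (∀ i → Inverse.to (DHom.bij f) i ≡ Inverse.to (DHom.bij g) i)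
                 × (∀ j → DHom.fun f j ≡ DHom.fun g j)
  ; idC = DId
  ; _∙_ = DComp
  }

eqBij : ∀ {n m} → n ≡ m → Fin n ↔ Fin m
eqBij {n} refl = ↔-id (Fin n)

eqBij-to : ∀ {n m} (e : n ≡ m) (i : Fin n) → Inverse.to (eqBij e) i ≡ subst Fin e i
eqBij-to refl i = refl

inclusion : FunData 𝒞 𝒟
inclusion = record
  { F₀ = λ P → P
  ; F₁ = λ {P} {Q} f → record
      { bij = eqBij (CHom.sameDom f)
      ; fun = CHom.fun f
      ; funSurj = CHom.funSurj f
      ; commutes = λ i → trans (CHom.commutes f i)
                          (cong (map Q) (sym (eqBij-to (CHom.sameDom f) i)))
      }
  }

-- 𝒟 differs from 𝒞 only in allowing a bijection between the domains, and
-- equality of 𝒟-arrows includes equality of the codomain maps, so all the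
-- comparison functors are faithful.  An arrow of 𝒞 whose image is isomorphic
-- to an identity has a bijective codomain map and is therefore invertible in
-- 𝒞; hence a chain whose image is isomorphic to a degenerate chain is itself
-- isomorphic to a degenerate chain.  For inner faces, the domain bijection of
-- an intermediate component is forced by its neighbours, which gives
-- fullness; and a factorisation in 𝒟 of an arrow isomorphic to an arrow h of
-- 𝒞 is isomorphic to a factorisation of h in 𝒞, obtained by relabelling the
-- domain of the middle object along the given bijections.
module Submission where

open import Defs
open import Data.Nat using (suc)
open import Data.Fin using (Fin; zero; suc)
open import Data.Product using (Σ; _×_; _,_; proj₁; proj₂)
open import Relation.Binary.PropositionalEquality
  using (_≡_; refl; sym; trans; cong; subst; module ≡-Reasoning)
open import Relation.Binary.PropositionalEquality.Properties using (subst-subst-sym)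
open import Function.Bundles using (_↔_; Inverse)
open import Function.Construct.Symmetry using (↔-sym)
open import Function.Construct.Composition using (_↔-∘_)

module NC = Nerve 𝒞
module ND = Nerve 𝒟
open NerveMap inclusion
open SurjObj

ι : ∀ {P Q} → CHom P Q → DHom P Q
ι = FunData.F₁ inclusion

σ : ∀ {P Q} → DHom P Q → Fin (dom P) → Fin (dom Q)
σ f = Inverse.to (DHom.bij f)

infix 4 _≈C_ _≈D_
infixr 9 _∙C_ _∙D_

_≈C_ : ∀ {P Q} → CHom P Q → CHom P Q → Set
_≈C_ = CatData._≈_ 𝒞

_≈D_ : ∀ {P Q} → DHom P Q → DHom P Q → Set
_≈D_ = CatData._≈_ 𝒟

_∙C_ : ∀ {P Q R} → CHom Q R → CHom P Q → CHom P R
_∙C_ = CComp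

_∙D_ : ∀ {P Q R} → DHom Q R → DHom P Q → DHom P R
_∙D_ = DComp

-- Stated for pairs of functions rather than for DHom so that the arrows are
-- inferred by higher-order pattern unification.
≈D-sym : ∀ {A B X Y : Set} {f g : A → X} {f' g' : B → Y} →
         (∀ i → f i ≡ g i) × (∀ j → f' j ≡ g' j) → (∀ i → g i ≡ f i) × (∀ j → g' j ≡ f' j)
≈D-sym (e , e') = (λ i → sym (e i)) , (λ j → sym (e' j))

CId-iso : ∀ {P} → NC.IsIso {P} CId CId
CId-iso = (λ _ → refl) , (λ _ → refl)

σ-ι : ∀ {P Q} (f : CHom P Q) i → σ (ι f) i ≡ subst Fin (CHom.sameDom f) i
σ-ι f = eqBij-to (CHom.sameDom f)

σ-ι-∙ : ∀ {P Q R} (g : CHom Q R) (f : CHom P Q) i → σ (ι (g ∙C f)) i ≡ σ (ι g) (σ (ι f) i)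
σ-ι-∙ g f = eqBij-trans (CHom.sameDom f) (CHom.sameDom g)
  where
  eqBij-trans : ∀ {a b c} (e₁ : a ≡ b) (e₂ : b ≡ c) i →
       Inverse.to (eqBij (trans e₁ e₂)) i ≡ Inverse.to (eqBij e₂) (Inverse.to (eqBij e₁) i)
  eqBij-trans refl refl i = refl

EqCᶜ-refl : ∀ {n a c a' c'} {s : NC.Chain n a c} {t : NC.Chain n a' c'}
            (φ : NC.PHomC s t) → NC.EqC φ φ
EqCᶜ-refl (NC.[]ᵐ _ _) _ = refl
EqCᶜ-refl (_ NC.∷ᵐ φ) = (λ _ → refl) , EqCᶜ-refl φ

EqCᴰ-sym : ∀ {n a c a' c'} {s : ND.Chain n a c} {t : ND.Chain n a' c'}
           (φ ψ : ND.PHomC s t) → ND.EqC φ ψ → ND.EqC ψ φ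
EqCᴰ-sym (ND.[]ᵐ _ _) (ND.[]ᵐ _ _) e = ≈D-sym e
EqCᴰ-sym (_ ND.∷ᵐ φ) (_ ND.∷ᵐ ψ) (e , es) = ≈D-sym e , EqCᴰ-sym φ ψ es

idPH-head : ∀ {n a c} (r : NC.Chain n a c) j →
            CHom.fun (proj₁ (NC.headPair (NC.idPH r))) j ≡ j
idPH-head NC.[] _ = refl
idPH-head (_ NC.∷ _) _ = refl

idPH-valid : ∀ {n a c} (r : NC.Chain n a c) → NC.ValidC (NC.idPH r)
idPH-valid {a = a} NC.[] = CId-iso {a}
idPH-valid {a = a} (_ NC.∷ r) = CId-iso {a} , (λ j → sym (idPH-head r _)) , idPH-valid r

compC-idPH-cancel : ∀ {n a c a' c'} {s : ND.Chain n a c} {t : ND.Chain n a' c'}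
                    (β ψ : ND.PHomC s t) →
                    ND.EqC (ND.compC β (ND.idPH s)) (ND.compC (ND.idPH t) ψ) → ND.EqC β ψ
compC-idPH-cancel (ND.[]ᵐ _ _) (ND.[]ᵐ _ _) e = e
compC-idPH-cancel (_ ND.∷ᵐ β) (_ ND.∷ᵐ ψ) (e , es) = e , compC-idPH-cancel β ψ es

-- Faithfulness

mapPH-reflects-≈ : ∀ {n a c a' c'} {s : NC.Chain n a c} {t : NC.Chain n a' c'}
                   (φ φ' : NC.PHomC s t) → ND.EqC (mapPH φ) (mapPH φ') → NC.EqC φ φ'
mapPH-reflects-≈ (NC.[]ᵐ _ _) (NC.[]ᵐ _ _) (_ , e) = e
mapPH-reflects-≈ (_ NC.∷ᵐ φ) (_ NC.∷ᵐ φ') ((_ , e) , es) = e , mapPH-reflects-≈ φ φ' es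

degenSquare-faithful : ∀ n (i : Fin (suc n)) → ComparisonFaithful (degenSquare n i)
degenSquare-faithful n i _ _ φ φ' _ _ _ e = mapPH-reflects-≈ φ φ' e

faceSquare-faithful : ∀ n (k : Fin (suc n)) → ComparisonFaithful (faceSquare n k)
faceSquare-faithful n k _ _ φ φ' _ _ e _ = mapPH-reflects-≈ φ φ' e

-- Degeneracy squares: fullness

withHead : ∀ {n a c a' c'} {s : NC.Chain n a c} {t : NC.Chain n a' c'} →
           CHom a a' × CHom a' a → NC.PHomC s t → NC.PHomC s t
withHead (u , v) (NC.[]ᵐ _ _) = NC.[]ᵐ u v
withHead p (_ NC.∷ᵐ ρ) = p NC.∷ᵐ ρ

-- Forgets the component at the inserted identity.  On valid families this
-- inverts dupAt, because naturality along an identity arrow forces the two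
-- components at the duplicated object to agree.
undupAt : ∀ {n a c a' c'} (i : Fin (suc n)) {s : NC.Chain n a c} {t : NC.Chain n a' c'} →
          NC.PHomC (NC.insId i s) (NC.insId i t) → NC.PHomC s t
undupAt zero (p NC.∷ᵐ ρ) = withHead p ρ
undupAt {suc n} (suc i) {_ NC.∷ _} {_ NC.∷ _} (p NC.∷ᵐ ρ) = p NC.∷ᵐ undupAt i ρ

headPair-undupAt : ∀ {n a c a' c'} (i : Fin (suc n)) {s : NC.Chain n a c} {t : NC.Chain n a' c'}
                   (α : NC.PHomC (NC.insId i s) (NC.insId i t)) →
                   NC.headPair (undupAt i α) ≡ NC.headPair α
headPair-undupAt zero (_ NC.∷ᵐ NC.[]ᵐ _ _) = refl
headPair-undupAt zero (_ NC.∷ᵐ (_ NC.∷ᵐ _)) = refl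
headPair-undupAt {suc n} (suc i) {_ NC.∷ _} {_ NC.∷ _} (_ NC.∷ᵐ _) = refl

undupAt-valid : ∀ {n a c a' c'} (i : Fin (suc n)) {s : NC.Chain n a c} {t : NC.Chain n a' c'}
                (α : NC.PHomC (NC.insId i s) (NC.insId i t)) → NC.ValidC α → NC.ValidC (undupAt i α)
undupAt-valid zero (_ NC.∷ᵐ NC.[]ᵐ _ _) (iso , _) = iso
undupAt-valid zero {_ NC.∷ _} {f' NC.∷ _} (_ NC.∷ᵐ (_ NC.∷ᵐ ρ)) (iso , nat , (_ , nat' , vρ)) =
  iso , (λ j → trans (cong (CHom.fun f') (nat j)) (nat' j)) , vρ
undupAt-valid {suc n} (suc i) {f NC.∷ _} {f' NC.∷ _} ((u , _) NC.∷ᵐ α) (iso , nat , vα) =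
  iso ,
  subst (λ h → ∀ j → CHom.fun f' (CHom.fun u j) ≡ CHom.fun (proj₁ h) (CHom.fun f j))
        (sym (headPair-undupAt i α)) nat ,
  undupAt-valid i α vα

dupAt-undupAt : ∀ {n a c a' c'} (i : Fin (suc n)) {s : NC.Chain n a c} {t : NC.Chain n a' c'}
                (α : NC.PHomC (NC.insId i s) (NC.insId i t)) → NC.ValidC α →
                NC.EqC (NC.dupAt i (undupAt i α)) α
dupAt-undupAt zero (_ NC.∷ᵐ NC.[]ᵐ _ _) (_ , nat , _) = (λ _ → refl) , nat
dupAt-undupAt zero (_ NC.∷ᵐ (_ NC.∷ᵐ ρ)) (_ , nat , _) = (λ _ → refl) , nat , EqCᶜ-refl ρ
dupAt-undupAt {suc n} (suc i) {_ NC.∷ _} {_ NC.∷ _} (_ NC.∷ᵐ α) (_ , _ , vα) =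
  (λ _ → refl) , dupAt-undupAt i α vα

mapPH-undupAt : ∀ {n a c a' c'} (i : Fin (suc n)) {s : NC.Chain n a c} {t : NC.Chain n a' c'}
                (α : NC.PHomC (NC.insId i s) (NC.insId i t)) (β : ND.PHomC (mapCh s) (mapCh t)) →
                ND.EqC (ND.compC (ND.dupAt i β) (θdegen i s)) (ND.compC (θdegen i t) (mapPH α)) →
                ND.EqC (mapPH (undupAt i α)) β
mapPH-undupAt zero {NC.[]} {NC.[]} (_ NC.∷ᵐ NC.[]ᵐ _ _) (ND.[]ᵐ _ _) (e , _) = ≈D-sym e
mapPH-undupAt zero {_ NC.∷ _} {_ NC.∷ _} (_ NC.∷ᵐ (_ NC.∷ᵐ ρ)) (_ ND.∷ᵐ β) (e , _ , es) =
  ≈D-sym e , EqCᴰ-sym β (mapPH ρ) (compC-idPH-cancel β (mapPH ρ) es)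
mapPH-undupAt {suc n} (suc i) {_ NC.∷ _} {_ NC.∷ _} (_ NC.∷ᵐ α) (_ ND.∷ᵐ β) (e , es) =
  ≈D-sym e , mapPH-undupAt i α β es

degenSquare-full : ∀ n (i : Fin (suc n)) → ComparisonFull (degenSquare n i)
degenSquare-full n i _ _ α β vα _ c =
  undupAt i α , undupAt-valid i α vα , dupAt-undupAt i α vα , mapPH-undupAt i α β c

-- Degeneracy squares: essential surjectivity

module SquareInverse {A B C : Set} (f : A → B) (g₀ : A → C) (g₀⁻¹ : C → A)
         (g₁ : B → C) (g₁⁻¹ : C → B) (g₀⁻¹∘g₀ : ∀ a → g₀⁻¹ (g₀ a) ≡ a)
         (g₀∘g₀⁻¹ : ∀ c → g₀ (g₀⁻¹ c) ≡ c) (g₁⁻¹∘g₁ : ∀ b → g₁⁻¹ (g₁ b) ≡ b)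
         (square : ∀ a → g₀ a ≡ g₁ (f a)) where

  inverseˡ : ∀ a → g₀⁻¹ (g₁ (f a)) ≡ a
  inverseˡ a = trans (cong g₀⁻¹ (sym (square a))) (g₀⁻¹∘g₀ a)

  inverseʳ : ∀ b → f (g₀⁻¹ (g₁ b)) ≡ b
  inverseʳ b = begin
    f (g₀⁻¹ (g₁ b))              ≡⟨ sym (g₁⁻¹∘g₁ _) ⟩
    g₁⁻¹ (g₁ (f (g₀⁻¹ (g₁ b))))  ≡⟨ cong g₁⁻¹ (sym (square _)) ⟩
    g₁⁻¹ (g₀ (g₀⁻¹ (g₁ b)))      ≡⟨ cong g₁⁻¹ (g₀∘g₀⁻¹ _) ⟩
    g₁⁻¹ (g₁ b)                  ≡⟨ g₁⁻¹∘g₁ b ⟩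
    b                            ∎
    where open ≡-Reasoning

CHom-inverse : ∀ {P Q} (f : CHom P Q) (g : Fin (cod Q) → Fin (cod P)) →
               (∀ j → g (CHom.fun f j) ≡ j) → (∀ y → CHom.fun f (g y) ≡ y) →
               Σ (CHom Q P) (NC.IsIso f)
CHom-inverse {P} {Q} f g g∘f f∘g = f⁻¹ , g∘f , f∘g
  where
  open CHom f
  f⁻¹ : CHom Q P
  f⁻¹ = record
    { sameDom = sym sameDom
    ; fun = g
    ; funSurj = λ j → fun j , g∘f j
    ; commutes = λ i → trans (cong g (trans (cong (map Q) (sym (subst-subst-sym sameDom)))
                                            (sym (commutes _))))
                             (g∘f _)
    }

-- The inclusion is conservative: an arrow of 𝒞 whose image is isomorphic
-- in the arrow category of 𝒟 to an identity is invertible.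
CHom-invertible : ∀ {P Q B} (f : CHom P Q) (g₀ : DHom P B) (g₀⁻¹ : DHom B P)
                  (g₁ : DHom Q B) (g₁⁻¹ : DHom B Q) → ND.IsIso g₀ g₀⁻¹ → ND.IsIso g₁ g₁⁻¹ →
                  (DId ∙D g₀) ≈D (g₁ ∙D ι f) → Σ (CHom Q P) (NC.IsIso f)
CHom-invertible f g₀ g₀⁻¹ g₁ g₁⁻¹ ((_ , l₀) , (_ , r₀)) ((_ , l₁) , _) (_ , nat) =
  CHom-inverse f _ (inverseˡ l₀ r₀ l₁ nat) (inverseʳ l₀ r₀ l₁ nat)
  where
  open SquareInverse (CHom.fun f) (DHom.fun g₀) (DHom.fun g₀⁻¹) (DHom.fun g₁) (DHom.fun g₁⁻¹)

compC-idPH-mapPH : ∀ {n a c b d} (r : NC.Chain n a c) {t : ND.Chain n b d}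
                   (ψ : ND.PHomC (mapCh r) t) →
                   ND.EqC (ND.compC ψ (ND.idPH (mapCh r))) (ND.compC ψ (mapPH (NC.idPH r)))
compC-idPH-mapPH NC.[] (ND.[]ᵐ _ _) = (λ _ → refl) , (λ _ → refl)
compC-idPH-mapPH (_ NC.∷ r) (_ ND.∷ᵐ ψ) = ((λ _ → refl) , (λ _ → refl)) , compC-idPH-mapPH r ψ

dupAt-head-≈ : ∀ {n a c b d e} (i : Fin (suc n)) (x : NC.Chain n a c) {t : ND.Chain n b d}
               {r : NC.Chain (suc n) a e}
               (β : ND.PHomC (mapCh x) t) (γ : ND.PHomC (mapCh r) (ND.insId i t))
               (α : NC.PHomC (NC.insId i x) r) → NC.headPair α ≡ (CId , CId) →
               ND.EqC (ND.compC (ND.dupAt i β) (θdegen i x)) (ND.compC γ (mapPH α)) →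
               proj₁ (ND.headPair β) ≈D proj₁ (ND.headPair γ)
dupAt-head-≈ zero _ _ (_ ND.∷ᵐ _) (_ NC.∷ᵐ _) refl (e , _) = e
dupAt-head-≈ {suc n} (suc i) (_ NC.∷ _) {_ ND.∷ _} {_ NC.∷ _} (_ ND.∷ᵐ _) (_ ND.∷ᵐ _)
  (_ NC.∷ᵐ _) refl (e , _) = e

-- An essential preimage of (s, t, γ) under the comparison functor.  Asking
-- the first component of α to be the identity lets the inductive step read
-- the head of β off γ.
record DegenPreimage {n a c b d} (i : Fin (suc n)) (s : NC.Chain (suc n) a c)
                   (t : ND.Chain n b d) (γ : ND.PHomC (mapCh s) (ND.insId i t)) : Set where
  field
    {end} : SurjObj
    x : NC.Chain n a end
    α : NC.PHomC (NC.insId i x) s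
    β : ND.PHomC (mapCh x) t
    α-valid : NC.ValidC α
    β-valid : ND.ValidC β
    α-head : NC.headPair α ≡ (CId , CId)
    commutes : ND.EqC (ND.compC (ND.dupAt i β) (θdegen i x)) (ND.compC γ (mapPH α))

degenPreimage : ∀ {n a c b d} (i : Fin (suc n)) (s : NC.Chain (suc n) a c)
              (t : ND.Chain n b d) (γ : ND.PHomC (mapCh s) (ND.insId i t)) →
              ND.ValidC γ → DegenPreimage i s t γ
degenPreimage {a = a} zero (f NC.∷ NC.[]) ND.[] ((γ₀ , γ₀⁻¹) ND.∷ᵐ ND.[]ᵐ γ₁ γ₁⁻¹)
            (iso₀ , nat₀ , iso₁) = record
  { x = NC.[]
  ; α = (CId , CId) NC.∷ᵐ NC.[]ᵐ f (proj₁ f⁻¹)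
  ; β = ND.[]ᵐ γ₀ γ₀⁻¹
  ; α-valid = CId-iso {a} , (λ _ → refl) , proj₂ f⁻¹
  ; β-valid = iso₀
  ; α-head = refl
  ; commutes = ((λ _ → refl) , (λ _ → refl)) , nat₀
  }
  where
  f⁻¹ : Σ (CHom _ a) (NC.IsIso f)
  f⁻¹ = CHom-invertible f γ₀ γ₀⁻¹ γ₁ γ₁⁻¹ iso₀ iso₁ nat₀
degenPreimage {a = a} zero (f NC.∷ (f₁ NC.∷ r)) (b₀ ND.∷ _)
            ((γ₀ , γ₀⁻¹) ND.∷ᵐ ((γ₁ , γ₁⁻¹) ND.∷ᵐ γ''))
            (iso₀ , nat₀ , (iso₁ , nat₁ , vγ'')) = record
  { x = (f₁ ∙C f) NC.∷ r
  ; α = (CId , CId) NC.∷ᵐ ((f , proj₁ f⁻¹) NC.∷ᵐ NC.idPH r)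
  ; β = (γ₀ , γ₀⁻¹) ND.∷ᵐ γ''
  ; α-valid = CId-iso {a} , (λ _ → refl) , proj₂ f⁻¹ , (λ _ → sym (idPH-head r _)) , idPH-valid r
  ; β-valid = iso₀ , nat , vγ''
  ; α-head = refl
  ; commutes = ((λ _ → refl) , (λ _ → refl)) , nat₀ , compC-idPH-mapPH r γ''
  }
  where
  f⁻¹ : Σ (CHom _ a) (NC.IsIso f)
  f⁻¹ = CHom-invertible f γ₀ γ₀⁻¹ γ₁ γ₁⁻¹ iso₀ iso₁ nat₀
  nat : (b₀ ∙D γ₀) ≈D (proj₁ (ND.headPair γ'') ∙D ι (f₁ ∙C f))
  nat = (λ i → trans (cong (σ b₀) (proj₁ nat₀ i))
                 (trans (proj₁ nat₁ _) (cong (σ (proj₁ (ND.headPair γ''))) (sym (σ-ι-∙ f₁ f i))))) ,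
        (λ j → trans (cong (DHom.fun b₀) (proj₂ nat₀ j)) (proj₂ nat₁ _))
degenPreimage {suc n} {a = a} (suc i) (f NC.∷ r) (b₀ ND.∷ t) ((γ₀ , γ₀⁻¹) ND.∷ᵐ γ')
            (iso₀ , nat₀ , vγ') = record
  { x = f NC.∷ R.x
  ; α = (CId , CId) NC.∷ᵐ R.α
  ; β = (γ₀ , γ₀⁻¹) ND.∷ᵐ R.β
  ; α-valid = CId-iso {a} , natα , R.α-valid
  ; β-valid = iso₀ , natβ , R.β-valid
  ; α-head = refl
  ; commutes = ((λ _ → refl) , (λ _ → refl)) , R.commutes
  }
  where
  module R = DegenPreimage (degenPreimage i r t γ' vγ')
  natα : (f ∙C CId) ≈C (proj₁ (NC.headPair R.α) ∙C f)
  natα j = subst (λ h → CHom.fun f j ≡ CHom.fun (proj₁ h) (CHom.fun f j)) (sym R.α-head) refl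
  head : proj₁ (ND.headPair R.β) ≈D proj₁ (ND.headPair γ')
  head = dupAt-head-≈ i R.x R.β γ' R.α R.α-head R.commutes
  natβ : (b₀ ∙D γ₀) ≈D (proj₁ (ND.headPair R.β) ∙D ι f)
  natβ = (λ k → trans (proj₁ nat₀ k) (sym (proj₁ head _))) ,
         (λ j → trans (proj₂ nat₀ j) (sym (proj₂ head _)))

degenSquare-essSurj : ∀ n (i : Fin (suc n)) → ComparisonEssSurj (degenSquare n i)
degenSquare-essSurj n i a b γ vγ = NC.nobj x , α , β , α-valid , β-valid , commutes
  where open DegenPreimage (degenPreimage i (NC.NObj.chain a) (ND.NObj.chain b) γ vγ)

-- Face squares: fullness

toCHom : ∀ {P Q} (h : DHom P Q) (e : dom P ≡ dom Q) → (∀ i → σ h i ≡ subst Fin e i) → CHom P Q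
toCHom {Q = Q} h e σ≡subst = record
  { sameDom = e
  ; fun = DHom.fun h
  ; funSurj = DHom.funSurj h
  ; commutes = λ i → trans (DHom.commutes h i) (cong (map Q) (σ≡subst i))
  }

ι-toCHom : ∀ {P Q} (h : DHom P Q) (e : dom P ≡ dom Q) (σ≡subst : ∀ i → σ h i ≡ subst Fin e i) →
           ι (toCHom h e σ≡subst) ≈D h
ι-toCHom h e σ≡subst = (λ i → trans (σ-ι (toCHom h e σ≡subst) i) (sym (σ≡subst i))) , (λ _ → refl)

σ-inverse-subst : ∀ {P Q} (u : DHom P Q) (v : DHom Q P) (e : dom P ≡ dom Q) →
                  (∀ i → σ u i ≡ subst Fin e i) → (∀ i → σ v (σ u i) ≡ i) →
                  ∀ i → σ v i ≡ subst Fin (sym e) i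
σ-inverse-subst u v e σu≡subst v∘u i =
  trans (cong (σ v) (sym (trans (σu≡subst _) (subst-subst-sym e)))) (v∘u _)

subst-square : ∀ {A B A' B'} (ef : A ≡ B) (eb : A ≡ A') (ef' : A' ≡ B') (h : Fin B → Fin B') →
               (∀ j → subst Fin ef' (subst Fin eb j) ≡ h (subst Fin ef j)) →
               ∀ i → h i ≡ subst Fin (trans (sym ef) (trans eb ef')) i
subst-square refl refl refl h square i = sym (square i)

mapPH-head-≈ : ∀ {n a c a' c'} {r : NC.Chain n a c} {r' : NC.Chain n a' c'}
               (β : NC.PHomC r r') (α : ND.PHomC (mapCh r) (mapCh r')) →
               ND.EqC (ND.compC (mapPH β) (ND.idPH (mapCh r))) (ND.compC (ND.idPH (mapCh r')) α) →
               ι (proj₁ (NC.headPair β)) ≈D proj₁ (ND.headPair α)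
mapPH-head-≈ (NC.[]ᵐ _ _) (ND.[]ᵐ _ _) e = e
mapPH-head-≈ (_ NC.∷ᵐ _) (_ ND.∷ᵐ _) (e , _) = e

dropAt-head-≈ : ∀ {n a c a' c'} (k : Fin (suc n)) {s : NC.Chain (suc (suc n)) a c}
                {s' : NC.Chain (suc (suc n)) a' c'}
                (φ : NC.PHomC s s') (β : NC.PHomC (NC.compAt k s) (NC.compAt k s')) →
                NC.EqC (NC.dropAt k φ) β → proj₁ (NC.headPair φ) ≈C proj₁ (NC.headPair β)
dropAt-head-≈ zero (_ NC.∷ᵐ (_ NC.∷ᵐ _)) (_ NC.∷ᵐ _) (e , _) = e
dropAt-head-≈ {suc n} (suc k) {_ NC.∷ _} {_ NC.∷ _} (_ NC.∷ᵐ _) (_ NC.∷ᵐ _) (e , _) = e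

-- At the composed pair of arrows, the component of α between them has its
-- domain bijection forced by the neighbouring components, which come from 𝒞;
-- hence it lies in the image of ι.
dropAt-lift : ∀ {n a c a' c'} (k : Fin (suc n)) (s : NC.Chain (suc (suc n)) a c)
              (s' : NC.Chain (suc (suc n)) a' c')
              (α : ND.PHomC (mapCh s) (mapCh s')) (β : NC.PHomC (NC.compAt k s) (NC.compAt k s')) →
              ND.ValidC α → NC.ValidC β →
              ND.EqC (ND.compC (mapPH β) (θface k s)) (ND.compC (θface k s') (ND.dropAt k α)) →
              Σ (NC.PHomC s s') λ φ → NC.ValidC φ × ND.EqC (mapPH φ) α × NC.EqC (NC.dropAt k φ) β
dropAt-lift zero (NC._∷_ {b = b} f (g NC.∷ r)) (NC._∷_ {b = b'} f' (g' NC.∷ r'))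
  ((α₀ , α₀⁻¹) ND.∷ᵐ ((α₁ , α₁⁻¹) ND.∷ᵐ α'')) ((β₀ , β₀⁻¹) NC.∷ᵐ β'')
  (_ , natα₀ , (isoα₁ , natα₁ , _)) (isoβ₀ , _ , vβ'') (e₀ , es) =
  φ , (isoβ₀ , nat₀ , (iso₁ , nat₁ , vβ'')) ,
      (e₀ , (ι-toCHom α₁ e σα₁ , compC-idPH-cancel (mapPH β'') α'' es)) ,
      ((λ _ → refl) , EqCᶜ-refl β'')
  where
  e : dom b ≡ dom b'
  e = trans (sym (CHom.sameDom f)) (trans (CHom.sameDom β₀) (CHom.sameDom f'))
  σα₁ : ∀ i → σ α₁ i ≡ subst Fin e i
  σα₁ = subst-square (CHom.sameDom f) (CHom.sameDom β₀) (CHom.sameDom f') (σ α₁) λ j →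
    trans (sym (σ-ι f' _)) (trans (cong (σ (ι f')) (sym (σ-ι β₀ j)))
      (trans (cong (σ (ι f')) (proj₁ e₀ j)) (trans (proj₁ natα₀ j) (cong (σ α₁) (σ-ι f j)))))
  m₁ : CHom b b'
  m₁ = toCHom α₁ e σα₁
  m₁⁻¹ : CHom b' b
  m₁⁻¹ = toCHom α₁⁻¹ (sym e) (σ-inverse-subst α₁ α₁⁻¹ e σα₁ (proj₁ (proj₁ isoα₁)))
  φ : NC.PHomC (f NC.∷ g NC.∷ r) (f' NC.∷ g' NC.∷ r')
  φ = (β₀ , β₀⁻¹) NC.∷ᵐ ((m₁ , m₁⁻¹) NC.∷ᵐ β'')
  nat₀ : (f' ∙C β₀) ≈C (m₁ ∙C f)
  nat₀ j = trans (cong (CHom.fun f') (proj₂ e₀ j)) (proj₂ natα₀ j)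
  iso₁ : NC.IsIso m₁ m₁⁻¹
  iso₁ = proj₂ (proj₁ isoα₁) , proj₂ (proj₂ isoα₁)
  nat₁ : (g' ∙C m₁) ≈C (proj₁ (NC.headPair β'') ∙C g)
  nat₁ j = trans (proj₂ natα₁ j) (sym (proj₂ (mapPH-head-≈ β'' α'' es) _))
dropAt-lift {suc n} (suc k) (f NC.∷ s) (f' NC.∷ s') ((α₀ , α₀⁻¹) ND.∷ᵐ α') ((β₀ , β₀⁻¹) NC.∷ᵐ β')
  (_ , _ , vα') (isoβ₀ , natβ₀ , vβ') (e₀ , es)
  with dropAt-lift k s s' α' β' vα' vβ' es
... | φ' , vφ' , φ'≈α' , φ'≈β' =
  ((β₀ , β₀⁻¹) NC.∷ᵐ φ') , (isoβ₀ , nat , vφ') , (e₀ , φ'≈α') , ((λ _ → refl) , φ'≈β')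
  where
  nat : (f' ∙C β₀) ≈C (proj₁ (NC.headPair φ') ∙C f)
  nat j = trans (natβ₀ j) (sym (dropAt-head-≈ k φ' β' φ'≈β' _))

faceSquare-full : ∀ n (k : Fin (suc n)) → ComparisonFull (faceSquare n k)
faceSquare-full n k x x' = dropAt-lift k (NC.NObj.chain x) (NC.NObj.chain x')

-- Face squares: essential surjectivity

conjugate : ∀ {A A' B B' : Set} (u : A → A') (v : A' → A) (u' : B → B') (v' : B' → B)
            (x : A → B) (x' : A' → B') → (∀ a → u (v a) ≡ a) → (∀ b → v' (u' b) ≡ b) →
            (∀ a → x' (u a) ≡ u' (x a)) → ∀ a → x (v a) ≡ v' (x' a)
conjugate u v u' v' x x' u∘v v'∘u' square a = begin
  x (v a)              ≡⟨ sym (v'∘u' _) ⟩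
  v' (u' (x (v a)))    ≡⟨ cong v' (sym (square (v a))) ⟩
  v' (x' (u (v a)))    ≡⟨ cong (λ z → v' (x' z)) (u∘v a) ⟩
  v' (x' a)            ∎
  where open ≡-Reasoning

≈D-conjugate : ∀ {P P' Q Q'} {u : DHom P P'} {v : DHom P' P} {u' : DHom Q Q'} {v' : DHom Q' Q}
               {x : DHom P Q} {x' : DHom P' Q'} → ND.IsIso u v → ND.IsIso u' v' →
               (x' ∙D u) ≈D (u' ∙D x) → (x ∙D v) ≈D (v' ∙D x')
≈D-conjugate {u = u} {v} {u'} {v'} {x} {x'} (_ , u∘v) (v'∘u' , _) (eσ , efun) =
  conjugate (σ u) (σ v) (σ u') (σ v') (σ x) (σ x') (proj₁ u∘v) (proj₁ v'∘u') eσ ,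
  conjugate (DHom.fun u) (DHom.fun v) (DHom.fun u') (DHom.fun v') (DHom.fun x) (DHom.fun x')
            (proj₂ u∘v) (proj₂ v'∘u') efun

IsIsoᴰ-swap : ∀ {P Q} {u : DHom P Q} {v : DHom Q P} → ND.IsIso u v → ND.IsIso v u
IsIsoᴰ-swap (v∘u , u∘v) = u∘v , v∘u

inverseᴰ : ∀ {n a c a' c'} {s : ND.Chain n a c} {t : ND.Chain n a' c'} →
           ND.PHomC s t → ND.PHomC t s
inverseᴰ (ND.[]ᵐ u v) = ND.[]ᵐ v u
inverseᴰ ((u , v) ND.∷ᵐ ψ) = (v , u) ND.∷ᵐ inverseᴰ ψ

headPair-inverseᴰ : ∀ {n a c a' c'} {s : ND.Chain n a c} {t : ND.Chain n a' c'}
                    (ψ : ND.PHomC s t) →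
                    proj₁ (ND.headPair (inverseᴰ ψ)) ≡ proj₂ (ND.headPair ψ)
headPair-inverseᴰ (ND.[]ᵐ _ _) = refl
headPair-inverseᴰ (_ ND.∷ᵐ _) = refl

headPair-iso : ∀ {n a c a' c'} {s : ND.Chain n a c} {t : ND.Chain n a' c'} (ψ : ND.PHomC s t) →
               ND.ValidC ψ → ND.IsIso (proj₁ (ND.headPair ψ)) (proj₂ (ND.headPair ψ))
headPair-iso (ND.[]ᵐ _ _) iso = iso
headPair-iso (_ ND.∷ᵐ _) (iso , _) = iso

inverseᴰ-valid : ∀ {n a c a' c'} {s : ND.Chain n a c} {t : ND.Chain n a' c'}
                 (ψ : ND.PHomC s t) → ND.ValidC ψ → ND.ValidC (inverseᴰ ψ)
inverseᴰ-valid (ND.[]ᵐ u v) iso = IsIsoᴰ-swap {u = u} {v} iso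
inverseᴰ-valid {s = f ND.∷ _} {t = f' ND.∷ _} ((u , v) ND.∷ᵐ ψ) (iso , nat , vψ) =
  IsIsoᴰ-swap {u = u} {v} iso ,
  subst (λ w → (f ∙D v) ≈D (w ∙D f')) (sym (headPair-inverseᴰ ψ))
        (≈D-conjugate {u = u} {v} {proj₁ (ND.headPair ψ)} {proj₂ (ND.headPair ψ)} {f} {f'}
                      iso (headPair-iso ψ vψ) nat) ,
  inverseᴰ-valid ψ vψ

compC-inverseᴰ : ∀ {n a c b d} (t : NC.Chain n b d) {r : ND.Chain n a c}
                 (ψ : ND.PHomC r (mapCh t)) → ND.ValidC ψ →
                 ND.EqC (ND.compC (mapPH (NC.idPH t)) (ND.idPH (mapCh t))) (ND.compC ψ (inverseᴰ ψ))
compC-inverseᴰ NC.[] (ND.[]ᵐ _ _) (_ , u∘v) = ≈D-sym u∘v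
compC-inverseᴰ (_ NC.∷ t) (_ ND.∷ᵐ ψ) ((_ , u∘v) , _ , vψ) = ≈D-sym u∘v , compC-inverseᴰ t ψ vψ

θface-head-≈ : ∀ {n a c b d e} (k : Fin (suc n)) (x : NC.Chain (suc (suc n)) b e)
               {s : ND.Chain (suc (suc n)) a c} {t : NC.Chain (suc n) b d}
               (β : NC.PHomC (NC.compAt k x) t) (γ : ND.PHomC (ND.compAt k s) (mapCh t))
               (α : ND.PHomC (mapCh x) s) → NC.headPair β ≡ (CId , CId) →
               ND.EqC (ND.compC (mapPH β) (θface k x)) (ND.compC γ (ND.dropAt k α)) →
               (ι (CId {b}) ∙D DId) ≈D (proj₁ (ND.headPair γ) ∙D proj₁ (ND.headPair α))
θface-head-≈ zero (_ NC.∷ (_ NC.∷ _)) {_ ND.∷ (_ ND.∷ _)} (_ NC.∷ᵐ _) (_ ND.∷ᵐ _)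
  (_ ND.∷ᵐ (_ ND.∷ᵐ _)) refl (e , _) = e
θface-head-≈ {suc n} (suc k) (_ NC.∷ _) {_ ND.∷ _} {_ NC.∷ _} (_ NC.∷ᵐ _) (_ ND.∷ᵐ _)
  (_ ND.∷ᵐ _) refl (e , _) = e

record Factorisation {o₀ o₁ o₂ b₀ b₂} (f : DHom o₀ o₁) (g : DHom o₁ o₂)
                     (γ₀⁻¹ : DHom b₀ o₀) (γ₂⁻¹ : DHom b₂ o₂) (h : CHom b₀ b₂) : Set where
  field
    {mid} : SurjObj
    first : CHom b₀ mid
    second : CHom mid b₂
    factors : ∀ j → CHom.fun h j ≡ CHom.fun second (CHom.fun first j)
    μ : DHom mid o₁
    μ⁻¹ : DHom o₁ mid
    μ-iso : ND.IsIso μ μ⁻¹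
    square₀ : (f ∙D γ₀⁻¹) ≈D (μ ∙D ι first)
    square₁ : (g ∙D μ) ≈D (γ₂⁻¹ ∙D ι second)

relabel : ∀ {m} (P : SurjObj) → Fin m ↔ Fin (dom P) → SurjObj
relabel P τ = surjObj _ (cod P) (λ i → map P (Inverse.to τ i))
                      (∘-surj (surj P) (λ y → Inverse.from τ y , Inverse.strictlyInverseˡ τ y))

relabel-to : ∀ {m} (P : SurjObj) (τ : Fin m ↔ Fin (dom P)) → DHom (relabel P τ) P
relabel-to P τ = record { bij = τ ; fun = λ z → z ; funSurj = id-surj ; commutes = λ _ → refl }

relabel-from : ∀ {m} (P : SurjObj) (τ : Fin m ↔ Fin (dom P)) → DHom P (relabel P τ)
relabel-from P τ = record
  { bij = ↔-sym τ ; fun = λ z → z ; funSurj = id-surj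
  ; commutes = λ i → cong (map P) (sym (Inverse.strictlyInverseˡ τ i))
  }

relabel-iso : ∀ {m} (P : SurjObj) (τ : Fin m ↔ Fin (dom P)) →
              ND.IsIso (relabel-to P τ) (relabel-from P τ)
relabel-iso P τ =
  (Inverse.strictlyInverseʳ τ , λ _ → refl) , (Inverse.strictlyInverseˡ τ , λ _ → refl)

-- Unique lifting of factorisations: if g ∘ f is isomorphic to ι h, then
-- (f, g) is isomorphic to a factorisation of h in 𝒞, whose middle object is
-- o₁ relabelled along the domain bijection from b₀.
factorisation : ∀ {o₀ o₁ o₂ b₀ b₂} (f : DHom o₀ o₁) (g : DHom o₁ o₂) (h : CHom b₀ b₂)
                (γ₀ : DHom o₀ b₀) (γ₀⁻¹ : DHom b₀ o₀) (γ₂ : DHom o₂ b₂) (γ₂⁻¹ : DHom b₂ o₂) →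
                ND.IsIso γ₀ γ₀⁻¹ → ND.IsIso γ₂ γ₂⁻¹ →
                (ι h ∙D γ₀) ≈D (γ₂ ∙D (g ∙D f)) → Factorisation f g γ₀⁻¹ γ₂⁻¹ h
factorisation {o₀} {o₁} {b₀ = b₀} {b₂} f g h γ₀ γ₀⁻¹ γ₂ γ₂⁻¹
              ((_ , γ₀⁻¹∘γ₀-fun) , (γ₀∘γ₀⁻¹ , γ₀∘γ₀⁻¹-fun))
              ((γ₂⁻¹∘γ₂ , γ₂⁻¹∘γ₂-fun) , (_ , γ₂∘γ₂⁻¹-fun)) (natσ , natfun) = record
  { first = first
  ; second = second
  ; factors = λ j → trans (cong (CHom.fun h) (sym (γ₀∘γ₀⁻¹-fun j))) (natfun _)
  ; μ = relabel-to o₁ τ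
  ; μ⁻¹ = relabel-from o₁ τ
  ; μ-iso = relabel-iso o₁ τ
  ; square₀ = (λ _ → refl) , (λ _ → refl)
  ; square₁ = (λ i → sym (begin
      σ γ₂⁻¹ (σ (ι h) i)                    ≡⟨ cong (λ z → σ γ₂⁻¹ (σ (ι h) z)) (sym (γ₀∘γ₀⁻¹ i)) ⟩
      σ γ₂⁻¹ (σ (ι h) (σ γ₀ (σ γ₀⁻¹ i)))    ≡⟨ cong (σ γ₂⁻¹) (natσ (σ γ₀⁻¹ i)) ⟩
      σ γ₂⁻¹ (σ γ₂ (σ g (σ f (σ γ₀⁻¹ i))))  ≡⟨ γ₂⁻¹∘γ₂ _ ⟩
      σ g (σ f (σ γ₀⁻¹ i))                  ∎)) ,
              (λ j → sym (γ₂⁻¹∘γ₂-fun _))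
  }
  where
  open ≡-Reasoning
  τ : Fin (dom b₀) ↔ Fin (dom o₁)
  τ = DHom.bij f ↔-∘ DHom.bij γ₀⁻¹

  F∘G₀⁻¹ : Fin (cod b₀) → Fin (cod o₁)
  F∘G₀⁻¹ j = DHom.fun f (DHom.fun γ₀⁻¹ j)

  F∘G₀⁻¹-commutes : ∀ i → F∘G₀⁻¹ (map b₀ i) ≡ map o₁ (Inverse.to τ i)
  F∘G₀⁻¹-commutes i = trans (cong (DHom.fun f) (DHom.commutes γ₀⁻¹ i)) (DHom.commutes f _)

  first : CHom b₀ (relabel o₁ τ)
  first = record
    { sameDom = refl
    ; fun = F∘G₀⁻¹
    ; funSurj = ∘-surj (DHom.funSurj f) (λ j → DHom.fun γ₀ j , γ₀⁻¹∘γ₀-fun j)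
    ; commutes = F∘G₀⁻¹-commutes
    }

  second : CHom (relabel o₁ τ) b₂
  second = record
    { sameDom = CHom.sameDom h
    ; fun = λ z → DHom.fun γ₂ (DHom.fun g z)
    ; funSurj = ∘-surj {g = DHom.fun γ₂} (λ j → DHom.fun γ₂⁻¹ j , γ₂∘γ₂⁻¹-fun j) (DHom.funSurj g)
    ; commutes = λ i → begin
        DHom.fun γ₂ (DHom.fun g (map o₁ (Inverse.to τ i)))
          ≡⟨ cong (λ z → DHom.fun γ₂ (DHom.fun g z)) (sym (F∘G₀⁻¹-commutes i)) ⟩
        DHom.fun γ₂ (DHom.fun g (F∘G₀⁻¹ (map b₀ i)))
          ≡⟨ sym (natfun _) ⟩
        CHom.fun h (DHom.fun γ₀ (DHom.fun γ₀⁻¹ (map b₀ i)))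
          ≡⟨ cong (CHom.fun h) (γ₀∘γ₀⁻¹-fun _) ⟩
        CHom.fun h (map b₀ i)
          ≡⟨ CHom.commutes h i ⟩
        map b₂ (subst Fin (CHom.sameDom h) i)
          ∎
    }

record FacePreimage {n a c b d} (k : Fin (suc n)) (s : ND.Chain (suc (suc n)) a c)
                    (t : NC.Chain (suc n) b d) (γ : ND.PHomC (ND.compAt k s) (mapCh t)) : Set where
  field
    {end} : SurjObj
    x : NC.Chain (suc (suc n)) b end
    α : ND.PHomC (mapCh x) s
    β : NC.PHomC (NC.compAt k x) t
    α-valid : ND.ValidC α
    β-valid : NC.ValidC β
    β-head : NC.headPair β ≡ (CId , CId)
    commutes : ND.EqC (ND.compC (mapPH β) (θface k x)) (ND.compC γ (ND.dropAt k α))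

facePreimage : ∀ {n a c b d} (k : Fin (suc n)) (s : ND.Chain (suc (suc n)) a c)
               (t : NC.Chain (suc n) b d) (γ : ND.PHomC (ND.compAt k s) (mapCh t)) →
               ND.ValidC γ → FacePreimage k s t γ
facePreimage {b = b} zero (f ND.∷ (g ND.∷ _)) (h NC.∷ t) ((γ₀ , γ₀⁻¹) ND.∷ᵐ γ')
             (iso₀ , nat₀ , vγ') = record
  { x = first NC.∷ (second NC.∷ t)
  ; α = (γ₀⁻¹ , γ₀) ND.∷ᵐ ((μ , μ⁻¹) ND.∷ᵐ inverseᴰ γ')
  ; β = (CId , CId) NC.∷ᵐ NC.idPH t
  ; α-valid = IsIsoᴰ-swap {u = γ₀} {γ₀⁻¹} iso₀ , square₀ ,
              (μ-iso ,
               subst (λ w → (g ∙D μ) ≈D (w ∙D ι second)) (sym (headPair-inverseᴰ γ')) square₁ ,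
               inverseᴰ-valid γ' vγ')
  ; β-valid = CId-iso {b} , (λ j → trans (factors j) (sym (idPH-head t _))) , idPH-valid t
  ; β-head = refl
  ; commutes = ≈D-sym (proj₂ iso₀) , compC-inverseᴰ t γ' vγ'
  }
  where
  open Factorisation (factorisation f g h γ₀ γ₀⁻¹ (proj₁ (ND.headPair γ')) (proj₂ (ND.headPair γ'))
                                    iso₀ (headPair-iso γ' vγ') nat₀)
facePreimage {suc n} {b = b} (suc k) (ND._∷_ {b = o₁} f s) (NC._∷_ {b = b₁} h t)
             ((γ₀ , γ₀⁻¹) ND.∷ᵐ γ')
             (iso₀ , nat₀ , vγ') = record
  { x = h NC.∷ R.x
  ; α = (γ₀⁻¹ , γ₀) ND.∷ᵐ R.α
  ; β = (CId , CId) NC.∷ᵐ R.β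
  ; α-valid = IsIsoᴰ-swap {u = γ₀} {γ₀⁻¹} iso₀ , natα , R.α-valid
  ; β-valid = CId-iso {b} , natβ , R.β-valid
  ; β-head = refl
  ; commutes = ≈D-sym (proj₂ iso₀) , R.commutes
  }
  where
  module R = FacePreimage (facePreimage k s t γ' vγ')
  γ₁ : DHom o₁ b₁
  γ₁ = proj₁ (ND.headPair γ')
  γ₁⁻¹ : DHom b₁ o₁
  γ₁⁻¹ = proj₂ (ND.headPair γ')
  iso₁ : ND.IsIso γ₁ γ₁⁻¹
  iso₁ = headPair-iso γ' vγ'
  conj : (f ∙D γ₀⁻¹) ≈D (γ₁⁻¹ ∙D ι h)
  conj = ≈D-conjugate {u = γ₀} {γ₀⁻¹} {γ₁} {γ₁⁻¹} {f} {ι h} iso₀ iso₁ nat₀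
  head : (ι (CId {b₁}) ∙D DId) ≈D (γ₁ ∙D proj₁ (ND.headPair R.α))
  head = θface-head-≈ k R.x R.β γ' R.α R.β-head R.commutes
  R-head : proj₁ (ND.headPair R.α) ≈D γ₁⁻¹
  R-head = (λ i → trans (sym (proj₁ (proj₁ iso₁) _)) (cong (σ γ₁⁻¹) (sym (proj₁ head i)))) ,
           (λ j → trans (sym (proj₂ (proj₁ iso₁) _)) (cong (DHom.fun γ₁⁻¹) (sym (proj₂ head j))))
  natα : (f ∙D γ₀⁻¹) ≈D (proj₁ (ND.headPair R.α) ∙D ι h)
  natα = (λ i → trans (proj₁ conj i) (sym (proj₁ R-head _))) ,
         (λ j → trans (proj₂ conj j) (sym (proj₂ R-head _)))
  natβ : (h ∙C CId) ≈C (proj₁ (NC.headPair R.β) ∙C h)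
  natβ j = subst (λ w → CHom.fun h j ≡ CHom.fun (proj₁ w) (CHom.fun h j)) (sym R.β-head) refl

faceSquare-essSurj : ∀ n (k : Fin (suc n)) → ComparisonEssSurj (faceSquare n k)
faceSquare-essSurj n k a b γ vγ = NC.nobj x , α , β , α-valid , β-valid , commutes
  where open FacePreimage (facePreimage k (ND.NObj.chain a) (NC.NObj.chain b) γ vγ)

lemma2p29 : NerveMap.IsCULF inclusion
lemma2p29 =
  (λ n i → degenSquare-full n i , degenSquare-faithful n i , degenSquare-essSurj n i) ,
  (λ n k → faceSquare-full n k , faceSquare-faithful n k , faceSquare-essSurj n k)
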